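{- Let $n$ be a prime number. Then every vector $A=(a_1,\ldots,a_k)$ of positive integers with $k>1$ and $f(A)=n$ satisfies $a_k=1$.
   Context: For a vector $A=(a_1,\ldots,a_k)$, $k\geq 1$, of positive integers define $f(A)$ recursively by $f(a_1)=a_1$ and $f(a_1,\ldots,a_{i+1})=(f(a_1,\ldots,a_i)+1)\,a_{i+1}$. -}

module Defs where

open import Data.Nat using (ℕ; suc; _+_; _*_)
open import Data.Vec using (Vec; []; _∷_; foldl₁)

-- f(a₁) = a₁ ;  f(a₁,…,a_{i+1}) = (f(a₁,…,a_i) + 1) * a_{i+1}
-- A vector (a₁,…,a_k) with k ≥ 1 is a Vec ℕ (suc m), k = suc m.
f : ∀ {m} → Vec ℕ (suc m) → ℕ
f = foldl₁ (λ acc a → (acc + 1) * a)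

module Submission where

-- Write f(a₁,…,a_k) = (P + 1) · a_k where P = f(a₁,…,a_{k-1}).
-- When k > 1 and all entries are positive, the prefix value P is itself
-- positive, so the factor P + 1 is at least 2.  A prime n = (P + 1) · a_k
-- with P + 1 ≥ 2 forces a_k = 1: a_k divides n, hence a_k is 1 or n, and
-- a_k = n would give P + 1 = 1.

open import Defs
open import Data.Nat using (ℕ; suc; _<_; NonZero)
open import Data.Nat.Primality using (Prime)
open import Data.Vec using (Vec; last)
open import Data.Vec.Relation.Unary.All using (All)
open import Relation.Binary.PropositionalEquality using (_≡_)

open import Data.Nat using (zero; _+_; _*_; s≤s; >-nonZero⁻¹)
open import Data.Nat.Properties using (*-cancelʳ-≡; *-identityˡ; +-comm; >⇒≢; m<n+m)
open import Data.Nat.Divisibility using (divides)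
open import Data.Nat.Primality using (prime⇒irreducible; prime⇒nonZero)
open import Data.Vec using ([]; _∷_; foldl)
open import Data.Vec.Relation.Unary.All using (_∷_)
open import Data.Product using (∃; _×_; _,_)
open import Data.Sum using (inj₁; inj₂)
open import Relation.Binary.PropositionalEquality using (refl; sym; trans)
open import Relation.Nullary using (contradiction)

step : ℕ → ℕ → ℕ
step acc a = (acc + 1) * a

step-nonZero : ∀ acc a → NonZero a → NonZero (step acc a)
step-nonZero acc (suc a) _ rewrite +-comm acc 1 = _

foldl-step-factors : ∀ {k} acc (xs : Vec ℕ (suc k)) → NonZero acc → All NonZero xs →
                     ∃ λ P → NonZero P × foldl _ step acc xs ≡ (P + 1) * last xs
foldl-step-factors acc (x ∷ [])     acc≢0 _          = acc , acc≢0 , refl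
foldl-step-factors acc (x ∷ y ∷ ys) _     (x≢0 ∷ rest) =
  foldl-step-factors (step acc x) (y ∷ ys) (step-nonZero acc x x≢0) rest

-- If a prime p equals c · d with c > 1, then d = 1: d divides p, and d = p
-- would give c · p = 1 · p, hence c = 1 after cancelling p ≠ 0.
prime-cofactor≡1 : ∀ {p} c d → Prime p → p ≡ c * d → 1 < c → d ≡ 1
prime-cofactor≡1 {p} c d p-prime p≡cd 1<c
  with prime⇒irreducible p-prime (divides c p≡cd)
... | inj₁ d≡1 = d≡1
... | inj₂ refl = contradiction c≡1 (>⇒≢ 1<c)
  where
  c≡1 : c ≡ 1
  c≡1 = *-cancelʳ-≡ c 1 p {{prime⇒nonZero p-prime}} (trans (sym p≡cd) (sym (*-identityˡ p)))

corollary1 : (n : ℕ) → Prime n → (m : ℕ) → 1 < suc m → (A : Vec ℕ (suc m)) →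
    All NonZero A → f A ≡ n → last A ≡ 1
corollary1 n n-prime zero    (s≤s ()) _ _ _
corollary1 n n-prime (suc m) _ (a ∷ xs) (a≢0 ∷ xs≢0) fA≡n
  with foldl-step-factors a xs a≢0 xs≢0
... | P , P≢0 , fA≡[P+1]·last =
  prime-cofactor≡1 (P + 1) (last xs) n-prime (trans (sym fA≡n) fA≡[P+1]·last)
    (m<n+m 1 (>-nonZero⁻¹ P {{P≢0}}))
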